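{- Let $\alpha,\beta\in\{ -1,0,1\}$. Let $\tilde C\in\{0,1\}^{\tilde K\times n}$ and $\hat C\in\{0,1\}^{\hat K\times n}$ be cost matrices of ordinal objectives, and let $\mathbf 1\in\mathbb R^n$ be the all-ones vector. Then the matrix $$A=\begin{pmatrix}\alpha\,\tilde C\\ \mathbf 1^\top\\ \beta\,\hat C\end{pmatrix}$$ is totally unimodular. This matrix is the constraint matrix of the problem $\min\gamma f(x)$ s.t. $\alpha\tilde Cx=\tilde b,\ \mathbf 1^\top x=w,\ \beta\hat Cx=\hat b,\ x\in\{0,1\}^n$.
   Context: An ordinal objective on $n$ elements with $K$ ordered categories $\eta_1\prec\dots\prec\eta_K$ is given by an assignment $o:\{1,\dots,n\}\to\{\eta_1,\dots,\eta_K\}$. Its cost matrix $C\in\{0,1\}^{K\times n}$ has entries $C_{ji}=1$ if $j\le k$, where $o(i)=\eta_k$, and $C_{ji}=0$ otherwise. The matrices $\tilde C$ and $\hat C$ are cost matrices of two such ordinal objectives, with $\tilde K$ and $\hat K$ categories respectively. A matrix is totally unimodular if every square submatrix has determinant in $\{0,1,-1\}$. -}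

module Defs where

open import Data.Nat using (ℕ; zero; suc; _+_)
open import Data.Fin using (Fin; zero; suc; splitAt; punchIn; _≤_; _<_; _≤?_)
open import Relation.Nullary using (yes; no)
open import Data.Integer using (ℤ; +_; -_; _*_) renaming (_+_ to _+ℤ_)
open import Data.Sum using (_⊎_; inj₁; inj₂)
open import Relation.Binary.PropositionalEquality using (_≡_)

Matrix : ℕ → ℕ → Set
Matrix m n = Fin m → Fin n → ℤ

sumFin : ∀ {k} → (Fin k → ℤ) → ℤ
sumFin {zero}  f = + 0
sumFin {suc k} f = f zero +ℤ sumFin (λ j → f (suc j))

sign : ∀ {k} → Fin k → ℤ
sign zero    = + 1
sign (suc j) = - sign j

det : ∀ {k} → Matrix k k → ℤ
det {zero}  M = + 1
det {suc k} M =
  sumFin (λ j → sign j * (M zero j * det (λ r c → M (suc r) (punchIn j c))))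

StrictlyIncreasing : ∀ {k m} → (Fin k → Fin m) → Set
StrictlyIncreasing {k} f = ∀ (a b : Fin k) → a < b → f a < f b

submatrix : ∀ {m n k l} → Matrix m n → (Fin k → Fin m) → (Fin l → Fin n) → Matrix k l
submatrix M r c i j = M (r i) (c j)

TotallyUnimodular : ∀ {m n} → Matrix m n → Set
TotallyUnimodular {m} {n} M =
  ∀ (k : ℕ) (r : Fin k → Fin m) (c : Fin k → Fin n) →
  StrictlyIncreasing r → StrictlyIncreasing c →
  (det (submatrix M r c) ≡ + 0 ⊎ det (submatrix M r c) ≡ + 1 ⊎ det (submatrix M r c) ≡ - (+ 1))

-- An ordinal objective on n elements with K ordered categories η_1 ≺ … ≺ η_K:
-- an assignment o : Fin n → Fin K (category index, 0-based).
OrdinalObjective : ℕ → ℕ → Set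
OrdinalObjective n K = Fin n → Fin K

costMatrix : ∀ {n K} → OrdinalObjective n K → Matrix K n
costMatrix o j i with j ≤? o i
... | yes _ = + 1
... | no  _ = + 0

scale : ∀ {m n} → ℤ → Matrix m n → Matrix m n
scale a M i j = a * M i j

stack3 : ∀ {p q n} → Matrix p n → (Fin n → ℤ) → Matrix q n → Matrix (p + suc q) n
stack3 {p} {q} T row B i j with splitAt p i
... | inj₁ a = T a j
... | inj₂ zero = row j
... | inj₂ (suc b) = B b j

onesRow : ∀ {n} → Fin n → ℤ
onesRow _ = + 1

InUnitSet : ℤ → Set
InUnitSet a = a ≡ - (+ 1) ⊎ a ≡ + 0 ⊎ a ≡ + 1

-- Pulling the factors α, β ∈ {-1, 0, 1} out of the rows leaves a 0/1 matrix whose columns are intervals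
-- of consecutive rows once the rows of C̃ are listed in reverse: every column of C̃ and of Ĉ is an
-- initial segment, and 1ᵀ joins the two. Such interval matrices are totally unimodular. For a square
-- one, move the lowest row to the top; if it vanishes so does the determinant, and otherwise the columns
-- through it are nested intervals, so subtracting the shortest of them from the others leaves a unit
-- first row above a smaller interval matrix.

module Submission where

open import Defs
import Data.Nat as ℕ
open import Data.Nat using (ℕ; zero; suc; s≤s; z≤n; s≤s⁻¹)
import Data.Fin as Fin
open import Data.Fin using (Fin; zero; suc; punchIn; lift; splitAt; toℕ)
open import Data.Fin.Properties using (any?)
open import Data.Integer using (ℤ; +_; -_; _*_; _+_; _-_; +0; -[1+_]; _≤_)
import Data.Integer as ℤ
open import Data.Integer.Properties using (*-zeroʳ; *-identityˡ; *-distribˡ-+; neg-involutive; neg-distribˡ-*)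
import Data.Integer.Properties as ℤ
open import Data.Integer.Tactic.RingSolver using (solve-∀)
open import Data.Empty using (⊥-elim)
open import Data.List using (filter; allFin)
import Data.List.Extrema as Extrema
open import Data.List.Membership.Propositional.Properties using (∈-filter⁺; ∈-allFin)
import Data.List.Relation.Unary.All as All
open import Data.List.Relation.Unary.All.Properties using (all-filter)
open import Data.Product using (Σ; Σ-syntax; _×_; _,_)
open import Data.Sum using (_⊎_; inj₁; inj₂)
open import Data.Unit using (tt)
open import Level using (0ℓ)
open import Relation.Nullary using (¬_; Dec; yes; no; _×-dec_)
open import Relation.Nullary.Decidable using (toSum)
open import Relation.Unary using (Pred; Decidable)
open import Relation.Binary.PropositionalEquality

sumFin-cong : ∀ {k} {f g : Fin k → ℤ} → (∀ j → f j ≡ g j) → sumFin f ≡ sumFin g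
sumFin-cong {zero}  f≗g = refl
sumFin-cong {suc k} f≗g = cong₂ _+_ (f≗g zero) (sumFin-cong (λ j → f≗g (suc j)))

sumFin-zero : ∀ {k} {f : Fin k → ℤ} → (∀ j → f j ≡ +0) → sumFin f ≡ +0
sumFin-zero {zero}  f≗0 = refl
sumFin-zero {suc k} f≗0 = cong₂ _+_ (f≗0 zero) (sumFin-zero (λ j → f≗0 (suc j)))

sumFin-+ : ∀ {k} (f g : Fin k → ℤ) → sumFin (λ j → f j + g j) ≡ sumFin f + sumFin g
sumFin-+ {zero}  f g = refl
sumFin-+ {suc k} f g =
  trans (cong (_+_ (f zero + g zero)) (sumFin-+ (λ j → f (suc j)) (λ j → g (suc j))))
        (interchange (f zero) (g zero) _ _)
  where
  interchange : ∀ a b c d → a + b + (c + d) ≡ a + c + (b + d)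
  interchange = solve-∀

sumFin-scale : ∀ {k} (x : ℤ) (f : Fin k → ℤ) → sumFin (λ j → x * f j) ≡ x * sumFin f
sumFin-scale {zero}  x f = sym (*-zeroʳ x)
sumFin-scale {suc k} x f =
  trans (cong (_+_ (x * f zero)) (sumFin-scale x (λ j → f (suc j))))
        (sym (*-distribˡ-+ x (f zero) _))

sumFin-comm : ∀ {k l} (f : Fin k → Fin l → ℤ) →
  sumFin (λ i → sumFin (λ j → f i j)) ≡ sumFin (λ j → sumFin (λ i → f i j))
sumFin-comm {zero} {l} f = sym (sumFin-zero {l} (λ _ → refl))
sumFin-comm {suc k} f =
  trans (cong (_+_ (sumFin (f zero))) (sumFin-comm (λ i → f (suc i))))
        (sym (sumFin-+ (f zero) _))

sumFin-comm-scaled : ∀ {k l} (u : Fin k → ℤ) (v : Fin l → ℤ) (Q : Fin l → Fin k → ℤ) →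
  sumFin (λ j → u j * sumFin (λ i → v i * Q i j)) ≡ sumFin (λ i → v i * sumFin (λ j → u j * Q i j))
sumFin-comm-scaled {k} {l} u v Q = begin
    sumFin (λ j → u j * sumFin (λ i → v i * Q i j))
  ≡⟨ sumFin-cong {k} (λ j → sym (sumFin-scale (u j) (λ i → v i * Q i j))) ⟩
    sumFin (λ j → sumFin (λ i → u j * (v i * Q i j)))
  ≡⟨ sym (sumFin-comm (λ i j → u j * (v i * Q i j))) ⟩
    sumFin (λ i → sumFin (λ j → u j * (v i * Q i j)))
  ≡⟨ sumFin-cong {l} (λ i → trans (sumFin-cong {k} (λ j → *-left-commute (u j) (v i) (Q i j)))
                                  (sumFin-scale (v i) (λ j → u j * Q i j))) ⟩
    sumFin (λ i → v i * sumFin (λ j → u j * Q i j))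
  ∎
  where
  open ≡-Reasoning
  *-left-commute : ∀ u v q → u * (v * q) ≡ v * (u * q)
  *-left-commute = solve-∀

-- Determinants

det-cong : ∀ {k} {M N : Matrix k k} → (∀ r c → M r c ≡ N r c) → det M ≡ det N
det-cong {zero}  M≗N = refl
det-cong {suc k} M≗N = sumFin-cong λ j →
  cong₂ (λ a b → sign j * (a * b)) (M≗N zero j) (det-cong (λ r c → M≗N (suc r) (punchIn j c)))

det-zero-row₀ : ∀ {k} (M : Matrix (suc k) (suc k)) → (∀ j → M zero j ≡ +0) → det M ≡ +0
det-zero-row₀ {k} M row₀≗0 = sumFin-zero {suc k} λ j →
  trans (cong (λ x → sign j * (x * minor j)) (row₀≗0 j)) (vanish (sign j) (minor j))
  where
  minor : Fin (suc k) → ℤ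
  minor j = det (λ r c → M (suc r) (punchIn j c))
  vanish : ∀ s d → s * (+0 * d) ≡ +0
  vanish = solve-∀

det-unit-row₀ : ∀ {k} (M : Matrix (suc k) (suc k)) → M zero zero ≡ + 1 → (∀ j → M zero (suc j) ≡ +0) →
  det M ≡ det (λ r c → M (suc r) (suc c))
det-unit-row₀ {k} M pivot rest≗0 =
  trans (cong₂ _+_ (cong (λ x → + 1 * (x * minor zero)) pivot)
                   (sumFin-zero {k} λ j → trans (cong (λ x → sign (suc j) * (x * minor (suc j))) (rest≗0 j))
                                                (vanish (sign (suc j)) (minor (suc j)))))
        (simplify (minor zero))
  where
  minor : Fin (suc k) → ℤ
  minor j = det (λ r c → M (suc r) (punchIn j c))
  vanish : ∀ s d → s * (+0 * d) ≡ +0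
  vanish = solve-∀
  simplify : ∀ d → + 1 * (+ 1 * d) + +0 ≡ d
  simplify = solve-∀

prodFin : ∀ {k} → (Fin k → ℤ) → ℤ
prodFin {zero}  s = + 1
prodFin {suc k} s = s zero * prodFin (λ j → s (suc j))

det-scale-rows : ∀ {k} (s : Fin k → ℤ) (M : Matrix k k) → det (λ r c → s r * M r c) ≡ prodFin s * det M
det-scale-rows {zero}  s M = refl
det-scale-rows {suc k} s M =
  trans (sumFin-cong {suc k} λ j →
           trans (cong (λ d → sign j * ((s zero * M zero j) * d))
                       (det-scale-rows (λ r → s (suc r)) (minor j)))
                 (regroup (sign j) (s zero) (M zero j) (prodFin (λ r → s (suc r))) (det (minor j))))
        (sumFin-scale (s zero * prodFin (λ r → s (suc r))) (λ j → sign j * (M zero j * det (minor j))))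
  where
  minor : Fin (suc k) → Matrix k k
  minor j r c = M (suc r) (punchIn j c)
  regroup : ∀ g a m p d → g * ((a * m) * (p * d)) ≡ (a * p) * (g * (m * d))
  regroup = solve-∀

Minors : ℕ → ℕ → Set
Minors k m = (Fin k → Fin m) → ℤ

Extensional : ∀ {k m} → Minors k m → Set
Extensional R = ∀ f g → (∀ x → f x ≡ g x) → R f ≡ R g

-- Laplace expansion along a first row a, the remaining rows being given by their minors R f on the
-- columns selected by f.  In particular  det M = expand₁ (M zero) (λ f → det (λ r c → M (suc r) (f c))).
expand₁ : ∀ {k} → (Fin (suc k) → ℤ) → Minors k (suc k) → ℤ
expand₁ a R = sumFin (λ j → sign j * (a j * R (punchIn j)))

expand₂ : ∀ {k} → (a b : Fin (suc (suc k)) → ℤ) → Minors k (suc (suc k)) → ℤ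
expand₂ a b R = expand₁ a (λ f → expand₁ (λ c → b (f c)) (λ g → R (λ d → f (g d))))

-- The terms of expand₂ in which neither row uses column 0.
expand₂-tail : ∀ {k} → (a b : Fin (suc (suc k)) → ℤ) → Minors k (suc (suc k)) → ℤ
expand₂-tail a b R = sumFin (λ j → sign (suc j) * (a (suc j) *
  sumFin (λ c → sign (suc c) * (b (suc (punchIn j c)) * R (λ d → punchIn (suc j) (punchIn (suc c) d))))))

expand₂-split : ∀ {k} (a b : Fin (suc (suc k)) → ℤ) R →
  let R⁺ = λ f → R (λ d → suc (f d)) in
  expand₂ a b R ≡ a zero * expand₁ (λ c → b (suc c)) R⁺ - b zero * expand₁ (λ c → a (suc c)) R⁺
                  + expand₂-tail a b R
expand₂-split a b R = begin
    column₀ + sumFin (λ j → sign (suc j) * (a (suc j) * (+ 1 * (b zero * r j) + X j)))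
  ≡⟨ cong (_+_ column₀) (sumFin-cong λ j → distrib (sign j) (a (suc j)) (b zero) (r j) (X j)) ⟩
    column₀ + sumFin (λ j → (- b zero) * through₀ j + avoiding₀ j)
  ≡⟨ cong (_+_ column₀) (sumFin-+ (λ j → (- b zero) * through₀ j) avoiding₀) ⟩
    column₀ + (sumFin (λ j → (- b zero) * through₀ j) + expand₂-tail a b R)
  ≡⟨ cong (λ z → column₀ + (z + expand₂-tail a b R)) (sumFin-scale (- b zero) through₀) ⟩
    column₀ + ((- b zero) * Ha + expand₂-tail a b R)
  ≡⟨ rearrange (a zero) Hb (b zero) Ha (expand₂-tail a b R) ⟩
    a zero * Hb - b zero * Ha + expand₂-tail a b R
  ∎
  where
  open ≡-Reasoning
  R⁺ = λ f → R (λ d → suc (f d))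
  Hb = expand₁ (λ c → b (suc c)) R⁺
  Ha = expand₁ (λ c → a (suc c)) R⁺
  column₀ = + 1 * (a zero * Hb)
  r = λ j → R⁺ (punchIn j)
  X = λ j → sumFin (λ c → sign (suc c) * (b (suc (punchIn j c)) * R (λ d → punchIn (suc j) (punchIn (suc c) d))))
  through₀ = λ j → sign j * (a (suc j) * r j)
  avoiding₀ = λ j → sign (suc j) * (a (suc j) * X j)
  distrib : ∀ s a b r x → (- s) * (a * (+ 1 * (b * r) + x)) ≡ (- b) * (s * (a * r)) + (- s) * (a * x)
  distrib = solve-∀
  rearrange : ∀ a h b h' t → + 1 * (a * h) + ((- b) * h' + t) ≡ a * h - b * h' + t
  rearrange = solve-∀

expand₂-tail-zero : ∀ (a b : Fin 2 → ℤ) R → expand₂-tail {0} a b R ≡ +0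
expand₂-tail-zero a b R = sumFin-zero {1} (λ j → vanish (sign (suc j)) (a (suc j)))
  where
  vanish : ∀ s x → s * (x * +0) ≡ +0
  vanish = solve-∀

expand₂-tail-suc : ∀ {k} (a b : Fin (suc (suc (suc k))) → ℤ) R → Extensional R →
  expand₂-tail a b R ≡ expand₂ (λ j → a (suc j)) (λ j → b (suc j)) (λ f → R (lift 1 f))
expand₂-tail-suc {k} a b R R-ext = sumFin-cong λ j →
  trans (cong (λ z → sign (suc j) * (a (suc j) * z)) (tail≡-lifted j))
        (cancel-signs (sign j) (a (suc j)) (lifted j))
  where
  pull-sign : ∀ s b r → (- s) * (b * r) ≡ - (+ 1) * (s * (b * r))
  pull-sign = solve-∀
  cancel-signs : ∀ s a y → (- s) * (a * (- (+ 1) * y)) ≡ s * (a * y)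
  cancel-signs = solve-∀
  liftedMinor : Fin (suc (suc k)) → Fin (suc k) → ℤ
  liftedMinor j c = R (lift 1 (λ d → punchIn j (punchIn c d)))
  lifted : Fin (suc (suc k)) → ℤ
  lifted j = sumFin (λ c → sign c * (b (suc (punchIn j c)) * liftedMinor j c))
  tail≡-lifted : ∀ j →
    sumFin (λ c → sign (suc c) * (b (suc (punchIn j c)) * R (λ d → punchIn (suc j) (punchIn (suc c) d))))
      ≡ - (+ 1) * lifted j
  tail≡-lifted j =
    trans (sumFin-cong λ c →
             trans (cong (λ z → sign (suc c) * (b (suc (punchIn j c)) * z))
                         (R-ext (λ d → punchIn (suc j) (punchIn (suc c) d)) (lift 1 (λ d → punchIn j (punchIn c d)))
                                λ { zero → refl ; (suc d) → refl }))
                   (pull-sign (sign c) (b (suc (punchIn j c))) (liftedMinor j c)))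
          (sumFin-scale (- (+ 1)) (λ c → sign c * (b (suc (punchIn j c)) * liftedMinor j c)))

-- The two-row expansion is antisymmetric: peel off column 0 with expand₂-split; what remains is a
-- two-row expansion of one size less.
mutual
  expand₂-antisym : ∀ {k} (a b : Fin (suc (suc k)) → ℤ) R → Extensional R → expand₂ a b R ≡ - expand₂ b a R
  expand₂-antisym {k} a b R R-ext =
    trans (expand₂-split a b R)
    (trans (cong (λ t → a zero * Hb - b zero * Ha + t) (expand₂-tail-antisym k a b R R-ext))
    (trans (rearrange (a zero) Hb (b zero) Ha (expand₂-tail b a R))
           (cong -_ (sym (expand₂-split b a R)))))
    where
    Hb = expand₁ (λ c → b (suc c)) (λ f → R (λ d → suc (f d)))
    Ha = expand₁ (λ c → a (suc c)) (λ f → R (λ d → suc (f d)))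
    rearrange : ∀ a h b h' t → a * h - b * h' + - t ≡ - (b * h' - a * h + t)
    rearrange = solve-∀

  expand₂-tail-antisym : ∀ k (a b : Fin (suc (suc k)) → ℤ) R → Extensional R →
    expand₂-tail a b R ≡ - expand₂-tail b a R
  expand₂-tail-antisym zero a b R R-ext =
    trans (expand₂-tail-zero a b R) (cong -_ (sym (expand₂-tail-zero b a R)))
  expand₂-tail-antisym (suc k) a b R R-ext =
    trans (expand₂-tail-suc a b R R-ext)
    (trans (expand₂-antisym (λ j → a (suc j)) (λ j → b (suc j)) (λ f → R (lift 1 f))
              (λ f g f≗g → R-ext (lift 1 f) (lift 1 g) λ { zero → refl ; (suc d) → cong suc (f≗g d) }))
           (cong -_ (sym (expand₂-tail-suc b a R R-ext))))

expand₂-cong : ∀ {k} {a a' b b' : Fin (suc (suc k)) → ℤ} {R R' : Minors k (suc (suc k))} →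
  (∀ j → a j ≡ a' j) → (∀ j → b j ≡ b' j) → (∀ f → R f ≡ R' f) → expand₂ a b R ≡ expand₂ a' b' R'
expand₂-cong {k} a≗a' b≗b' R≗R' = sumFin-cong {suc (suc k)} λ j →
  cong₂ (λ x y → sign j * (x * y)) (a≗a' j)
        (sumFin-cong {suc k} λ c →
           cong₂ (λ x y → sign c * (x * y)) (b≗b' (punchIn j c)) (R≗R' (λ d → punchIn j (punchIn c d))))

det-swap₀₁ : ∀ {k} (P Q : Matrix (suc (suc k)) (suc (suc k))) →
  (∀ c → P zero c ≡ Q (suc zero) c) → (∀ c → P (suc zero) c ≡ Q zero c) →
  (∀ r c → P (suc (suc r)) c ≡ Q (suc (suc r)) c) → det P ≡ - det Q
det-swap₀₁ P Q row₀ row₁ rest =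
  trans (expand₂-cong row₀ row₁ (λ f → det-cong (λ r d → rest r (f d))))
        (expand₂-antisym (Q (suc zero)) (Q zero) (λ f → det (λ r d → Q (suc (suc r)) (f d)))
                         (λ f g f≗g → det-cong (λ r d → cong (Q (suc (suc r))) (f≗g d))))

det-equal-rows₀₁ : ∀ {k} (P : Matrix (suc (suc k)) (suc (suc k))) →
  (∀ c → P zero c ≡ P (suc zero) c) → det P ≡ +0
det-equal-rows₀₁ P row₀≗row₁ =
  self-negating (det P) (det-swap₀₁ P P row₀≗row₁ (λ c → sym (row₀≗row₁ c)) (λ r c → refl))
  where
  self-negating : ∀ x → x ≡ - x → x ≡ +0
  self-negating (+ zero)  _  = refl
  self-negating (+ suc n) ()
  self-negating -[1+ n ]  ()

det-linear-row₀ : ∀ {k} (P Q R : Matrix (suc k) (suc k)) (x : ℤ) →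
  (∀ c → P zero c ≡ Q zero c - x * R zero c) →
  (∀ r c → P (suc r) c ≡ Q (suc r) c) → (∀ r c → P (suc r) c ≡ R (suc r) c) →
  det P ≡ det Q - x * det R
det-linear-row₀ P Q R x row₀ P≗Q P≗R = begin
    sumFin (λ j → sign j * (P zero j * DP j))
  ≡⟨ sumFin-cong (λ j → trans (cong (λ u → sign j * (u * DP j)) (row₀ j))
        (split (sign j) (Q zero j) x (R zero j) (DP j) (DQ j) (DR j)
          (det-cong (λ r c → P≗Q r (punchIn j c))) (det-cong (λ r c → P≗R r (punchIn j c))))) ⟩
    sumFin (λ j → sign j * (Q zero j * DQ j) + (- x) * (sign j * (R zero j * DR j)))
  ≡⟨ sumFin-+ (λ j → sign j * (Q zero j * DQ j)) (λ j → (- x) * (sign j * (R zero j * DR j))) ⟩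
    det Q + sumFin (λ j → (- x) * (sign j * (R zero j * DR j)))
  ≡⟨ cong (_+_ (det Q)) (sumFin-scale (- x) (λ j → sign j * (R zero j * DR j))) ⟩
    det Q + (- x) * det R
  ≡⟨ minus (det Q) x (det R) ⟩
    det Q - x * det R
  ∎
  where
  open ≡-Reasoning
  DP = λ j → det (λ r c → P (suc r) (punchIn j c))
  DQ = λ j → det (λ r c → Q (suc r) (punchIn j c))
  DR = λ j → det (λ r c → R (suc r) (punchIn j c))
  split : ∀ s q x r d dq dr → d ≡ dq → d ≡ dr → s * ((q - x * r) * d) ≡ s * (q * dq) + (- x) * (s * (r * dr))
  split s q x r d _ _ refl refl = distrib s q x r d
    where
    distrib : ∀ s q x r d → s * ((q - x * r) * d) ≡ s * (q * d) + (- x) * (s * (r * d))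
    distrib = solve-∀
  minus : ∀ a x b → a + (- x) * b ≡ a - x * b
  minus = solve-∀

swapRows₀₁ : ∀ {k n} → Matrix (suc (suc k)) n → Matrix (suc (suc k)) n
swapRows₀₁ M zero          = M (suc zero)
swapRows₀₁ M (suc zero)    = M zero
swapRows₀₁ M (suc (suc r)) = M (suc (suc r))

det-subtract-row₀-from-row₁ : ∀ {k} (P Y : Matrix (suc (suc k)) (suc (suc k))) (x : ℤ) →
  (∀ c → P zero c ≡ Y zero c) → (∀ c → P (suc zero) c ≡ Y (suc zero) c - x * Y zero c) →
  (∀ r c → P (suc (suc r)) c ≡ Y (suc (suc r)) c) → det P ≡ det Y
det-subtract-row₀-from-row₁ {k} P Y x row₀ row₁ rest = begin
    det P
  ≡⟨ det-swap₀₁ P (swapRows₀₁ P) (λ c → refl) (λ c → refl) (λ r c → refl) ⟩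
    - det (swapRows₀₁ P)
  ≡⟨ cong -_ (det-linear-row₀ (swapRows₀₁ P) (swapRows₀₁ Y) C x row₁ P≗Y (λ r c → refl)) ⟩
    - (det (swapRows₀₁ Y) - x * det C)
  ≡⟨ cong₂ (λ u v → - (u - x * v))
           (det-swap₀₁ (swapRows₀₁ Y) Y (λ c → refl) (λ c → refl) (λ r c → refl))
           (det-equal-rows₀₁ C (λ c → sym (row₀ c))) ⟩
    - (- det Y - x * +0)
  ≡⟨ simplify (det Y) x ⟩
    det Y
  ∎
  where
  open ≡-Reasoning
  C : Matrix (suc (suc k)) (suc (suc k))
  C zero    = Y zero
  C (suc r) = swapRows₀₁ P (suc r)
  P≗Y : ∀ r c → swapRows₀₁ P (suc r) c ≡ swapRows₀₁ Y (suc r) c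
  P≗Y zero    c = row₀ c
  P≗Y (suc r) c = rest r c
  simplify : ∀ d x → - (- d - x * +0) ≡ d
  simplify = solve-∀

det-subtract-row₀ : ∀ {k} (P N : Matrix (suc k) (suc k)) (g : Fin k → ℤ) →
  (∀ c → P zero c ≡ N zero c) → (∀ i c → P (suc i) c ≡ N (suc i) c - g i * N zero c) → det P ≡ det N
det-subtract-row₀ {zero}  P N g row₀ rows = det-cong {1} {P} {N} λ { zero c → row₀ c }
det-subtract-row₀ {suc k} P N g row₀ rows =
  trans (det-subtract-row₀-from-row₁ P Y (g zero) row₀ (rows zero) (λ r c → rows (suc r) c)) det-Y
  where
  open ≡-Reasoning
  Y : Matrix (suc (suc k)) (suc (suc k))
  Y zero          c = N zero c
  Y (suc zero)    c = N (suc zero) c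
  Y (suc (suc i)) c = N (suc (suc i)) c - g (suc i) * N zero c
  -- Row 1 of Y is untouched, so expanding along it leaves minors of the same shape, one size smaller.
  det-Y : det Y ≡ det N
  det-Y = begin
      det Y
    ≡⟨ det-swap₀₁ Y (swapRows₀₁ Y) (λ c → refl) (λ c → refl) (λ r c → refl) ⟩
      - det (swapRows₀₁ Y)
    ≡⟨ cong -_ (sumFin-cong {suc (suc k)} λ j → cong (λ z → sign j * (N (suc zero) j * z))
         (det-subtract-row₀ (λ r c → swapRows₀₁ Y (suc r) (punchIn j c)) (λ r c → swapRows₀₁ N (suc r) (punchIn j c))
                            (λ i → g (suc i)) (λ c → refl) (λ i c → refl))) ⟩
      - det (swapRows₀₁ N)
    ≡⟨ cong -_ (det-swap₀₁ (swapRows₀₁ N) N (λ c → refl) (λ c → refl) (λ r c → refl)) ⟩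
      - - det N
    ≡⟨ neg-involutive (det N) ⟩
      det N
    ∎

det-move-row-to-front : ∀ {k} (a : Fin (suc k)) (P M : Matrix (suc k) (suc k)) →
  (∀ c → P zero c ≡ M a c) → (∀ i c → P (suc i) c ≡ M (punchIn a i) c) → det P ≡ sign a * det M
det-move-row-to-front {k} zero P M row₀ rows =
  trans (det-cong {suc k} {P} {M} λ { zero c → row₀ c ; (suc i) c → rows i c }) (sym (*-identityˡ (det M)))
det-move-row-to-front {suc k} (suc a) P M row₀ rows = begin
    det P
  ≡⟨ det-swap₀₁ P W row₀ (rows zero) (λ i c → rows (suc i) c) ⟩
    - det W
  ≡⟨ cong -_ (sumFin-cong {suc (suc k)} λ j → trans (cong (λ z → sign j * (M zero j * z))
         (det-move-row-to-front a (λ r c → W (suc r) (punchIn j c)) (λ r c → M (suc r) (punchIn j c))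
                                (λ c → refl) (λ i c → refl)))
         (commute (sign j) (M zero j) (sign a) (det (λ r c → M (suc r) (punchIn j c))))) ⟩
    - sumFin (λ j → sign a * (sign j * (M zero j * det (λ r c → M (suc r) (punchIn j c)))))
  ≡⟨ cong -_ (sumFin-scale (sign a) (λ j → sign j * (M zero j * det (λ r c → M (suc r) (punchIn j c))))) ⟩
    - (sign a * det M)
  ≡⟨ neg-distribˡ-* (sign a) (det M) ⟩
    sign (suc a) * det M
  ∎
  where
  open ≡-Reasoning
  W : Matrix (suc (suc k)) (suc (suc k))
  W zero          c = M zero c
  W (suc zero)    c = M (suc a) c
  W (suc (suc i)) c = M (suc (punchIn a i)) c
  commute : ∀ s m t d → s * (m * (t * d)) ≡ t * (s * (m * d))
  commute = solve-∀

-- Expanding the first-row minors along their first column and exchanging the two sums.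
det-expand-column₀ : ∀ {k} (M : Matrix (suc k) (suc k)) →
  det M ≡ sumFin (λ i → sign i * (M i zero * det (λ r c → M (punchIn i r) (suc c))))
det-expand-column₀ {zero}  M = refl
det-expand-column₀ {suc k} M = cong (_+_ corner) (begin
    sumFin (λ j → sign (suc j) * (M zero (suc j) * det (λ r c → M (suc r) (punchIn (suc j) c))))
  ≡⟨ sumFin-cong {suc k} (λ j → cong (λ z → sign (suc j) * (M zero (suc j) * z))
                                      (det-expand-column₀ (λ r c → M (suc r) (punchIn (suc j) c)))) ⟩
    sumFin (λ j → sign (suc j) * (M zero (suc j) * sumFin (λ i → sign i * (M (suc i) zero * Q i j))))
  ≡⟨ sumFin-cong {suc k} (λ j →
       trans (assoc-neg (sign j) (M zero (suc j)) (sumFin (λ i → sign i * (M (suc i) zero * Q i j))))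
             (cong (λ z → ((- sign j) * M zero (suc j)) * z)
                   (sumFin-cong {suc k} (λ i → assoc (sign i) (M (suc i) zero) (Q i j))))) ⟩
    sumFin (λ j → ((- sign j) * M zero (suc j)) * sumFin (λ i → (sign i * M (suc i) zero) * Q i j))
  ≡⟨ sumFin-comm-scaled (λ j → (- sign j) * M zero (suc j)) (λ i → sign i * M (suc i) zero) Q ⟩
    sumFin (λ i → (sign i * M (suc i) zero) * sumFin (λ j → ((- sign j) * M zero (suc j)) * Q i j))
  ≡⟨ sumFin-cong {suc k} (λ i → trans (cong (λ z → (sign i * M (suc i) zero) * z)
        (trans (sumFin-cong {suc k} (λ j → pull-sign (sign j) (M zero (suc j)) (Q i j)))
               (sumFin-scale (- (+ 1)) (λ j → sign j * (M zero (suc j) * Q i j)))))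
        (push-sign (sign i) (M (suc i) zero) (sumFin (λ j → sign j * (M zero (suc j) * Q i j))))) ⟩
    sumFin (λ i → sign (suc i) * (M (suc i) zero * sumFin (λ j → sign j * (M zero (suc j) * Q i j))))
  ∎)
  where
  open ≡-Reasoning
  corner = sign {suc (suc k)} zero * (M zero zero * det (λ r c → M (suc r) (suc c)))
  Q : Fin (suc k) → Fin (suc k) → ℤ
  Q i j = det (λ r c → M (suc (punchIn i r)) (suc (punchIn j c)))
  assoc-neg : ∀ s a x → (- s) * (a * x) ≡ ((- s) * a) * x
  assoc-neg = solve-∀
  assoc : ∀ s b q → s * (b * q) ≡ (s * b) * q
  assoc = solve-∀
  pull-sign : ∀ s a q → ((- s) * a) * q ≡ - (+ 1) * (s * (a * q))
  pull-sign = solve-∀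
  push-sign : ∀ s b y → (s * b) * (- (+ 1) * y) ≡ (- s) * (b * y)
  push-sign = solve-∀

det-transpose : ∀ {k} (M : Matrix k k) → det (λ r c → M c r) ≡ det M
det-transpose {zero}  M = refl
det-transpose {suc k} M =
  trans (sumFin-cong {suc k} λ j → cong (λ z → sign j * (M j zero * z))
                                        (det-transpose (λ r c → M (punchIn j r) (suc c))))
        (sym (det-expand-column₀ M))

det-move-column-to-front : ∀ {k} (a : Fin (suc k)) (P M : Matrix (suc k) (suc k)) →
  (∀ r → P r zero ≡ M r a) → (∀ r i → P r (suc i) ≡ M r (punchIn a i)) → det P ≡ sign a * det M
det-move-column-to-front a P M col₀ cols =
  trans (sym (det-transpose P))
  (trans (det-move-row-to-front a (λ r c → P c r) (λ r c → M c r) col₀ (λ i c → cols c i))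
         (cong (sign a *_) (det-transpose M)))

det-subtract-column₀ : ∀ {k} (P N : Matrix (suc k) (suc k)) (g : Fin k → ℤ) →
  (∀ r → P r zero ≡ N r zero) → (∀ r i → P r (suc i) ≡ N r (suc i) - g i * N r zero) → det P ≡ det N
det-subtract-column₀ P N g col₀ cols =
  trans (sym (det-transpose P))
  (trans (det-subtract-row₀ (λ r c → P c r) (λ r c → N c r) g col₀ (λ i c → cols c i))
         (det-transpose N))

-- Clear row 0 against the pivot entry M zero s = 1 by column operations, then delete row 0 and column s.
pivotMinor : ∀ {k} → Matrix (suc k) (suc k) → Fin (suc k) → Matrix k k
pivotMinor M s r j = M (suc r) (punchIn s j) - M zero (punchIn s j) * M (suc r) s

det-pivotMinor : ∀ {k} (M : Matrix (suc k) (suc k)) (s : Fin (suc k)) → M zero s ≡ + 1 →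
  det (pivotMinor M s) ≡ sign s * det M
det-pivotMinor {k} M s pivot = begin
    det (pivotMinor M s)
  ≡⟨ sym (det-unit-row₀ cleared pivot λ j →
       trans (cong (λ p → M zero (punchIn s j) - M zero (punchIn s j) * p) pivot) (x-x*1≡0 (M zero (punchIn s j)))) ⟩
    det cleared
  ≡⟨ det-subtract-column₀ cleared moved (λ j → M zero (punchIn s j)) (λ r → refl) (λ r i → refl) ⟩
    det moved
  ≡⟨ det-move-column-to-front s moved M (λ r → refl) (λ r i → refl) ⟩
    sign s * det M
  ∎
  where
  open ≡-Reasoning
  moved cleared : Matrix (suc k) (suc k)
  moved r zero    = M r s
  moved r (suc j) = M r (punchIn s j)
  cleared r zero    = M r s
  cleared r (suc j) = M r (punchIn s j) - M zero (punchIn s j) * M r s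
  x-x*1≡0 : ∀ x → x - x * + 1 ≡ +0
  x-x*1≡0 = solve-∀

Unimodular : ℤ → Set
Unimodular x = x ≡ +0 ⊎ x ≡ + 1 ⊎ x ≡ - (+ 1)

InUnitSet⇒Unimodular : ∀ {a} → InUnitSet a → Unimodular a
InUnitSet⇒Unimodular (inj₁ a≡-1)       = inj₂ (inj₂ a≡-1)
InUnitSet⇒Unimodular (inj₂ (inj₁ a≡0)) = inj₁ a≡0
InUnitSet⇒Unimodular (inj₂ (inj₂ a≡1)) = inj₂ (inj₁ a≡1)

Unimodular-* : ∀ {a b} → Unimodular a → Unimodular b → Unimodular (a * b)
Unimodular-* (inj₁ refl)        _                  = inj₁ refl
Unimodular-* (inj₂ (inj₁ refl)) (inj₁ refl)        = inj₁ refl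
Unimodular-* (inj₂ (inj₁ refl)) (inj₂ (inj₁ refl)) = inj₂ (inj₁ refl)
Unimodular-* (inj₂ (inj₁ refl)) (inj₂ (inj₂ refl)) = inj₂ (inj₂ refl)
Unimodular-* (inj₂ (inj₂ refl)) (inj₁ refl)        = inj₁ refl
Unimodular-* (inj₂ (inj₂ refl)) (inj₂ (inj₁ refl)) = inj₂ (inj₂ refl)
Unimodular-* (inj₂ (inj₂ refl)) (inj₂ (inj₂ refl)) = inj₂ (inj₁ refl)

Unimodular-neg : ∀ {a} → Unimodular a → Unimodular (- a)
Unimodular-neg (inj₁ refl)        = inj₁ refl
Unimodular-neg (inj₂ (inj₁ refl)) = inj₂ (inj₂ refl)
Unimodular-neg (inj₂ (inj₂ refl)) = inj₂ (inj₁ refl)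

Unimodular-sign : ∀ {k} (a : Fin k) → Unimodular (sign a)
Unimodular-sign zero    = inj₂ (inj₁ refl)
Unimodular-sign (suc a) = Unimodular-neg (Unimodular-sign a)

Unimodular-prodFin : ∀ {k} (s : Fin k → ℤ) → (∀ i → Unimodular (s i)) → Unimodular (prodFin s)
Unimodular-prodFin {zero}  s s-unimodular = inj₂ (inj₁ refl)
Unimodular-prodFin {suc k} s s-unimodular =
  Unimodular-* (s-unimodular zero) (Unimodular-prodFin (λ j → s (suc j)) (λ j → s-unimodular (suc j)))

sign-*-cancel : ∀ {k} (a : Fin k) x → sign a * (sign a * x) ≡ x
sign-*-cancel zero    x = trans (*-identityˡ (+ 1 * x)) (*-identityˡ x)
sign-*-cancel (suc a) x = trans (neg-neg (sign a) x) (sign-*-cancel a x)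
  where
  neg-neg : ∀ s x → (- s) * ((- s) * x) ≡ s * (s * x)
  neg-neg = solve-∀

Unimodular-unsign : ∀ {k} (a : Fin k) {x y} → y ≡ sign a * x → Unimodular y → Unimodular x
Unimodular-unsign a {x} refl y-unimodular =
  subst Unimodular (sign-*-cancel a x) (Unimodular-* (Unimodular-sign a) y-unimodular)

TotallyUnimodular-cong : ∀ {m n} {M N : Matrix m n} → (∀ i j → M i j ≡ N i j) →
  TotallyUnimodular M → TotallyUnimodular N
TotallyUnimodular-cong M≗N M-tu k r c r↑ c↑ =
  subst Unimodular (det-cong (λ i j → M≗N (r i) (c j))) (M-tu k r c r↑ c↑)

TotallyUnimodular-scale-rows : ∀ {m n} (s : Fin m → ℤ) (M : Matrix m n) → (∀ i → Unimodular (s i)) →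
  TotallyUnimodular M → TotallyUnimodular (λ i j → s i * M i j)
TotallyUnimodular-scale-rows s M s-unimodular M-tu k r c r↑ c↑ =
  subst Unimodular (sym (det-scale-rows (λ i → s (r i)) (submatrix M r c)))
    (Unimodular-* (Unimodular-prodFin (λ i → s (r i)) (λ i → s-unimodular (r i))) (M-tu k r c r↑ c↑))

-- Interval matrices

argminOn : ∀ {n} {P : Pred (Fin n) 0ℓ} → Decidable P → (f : Fin n → ℤ) → Σ (Fin n) P →
  Σ[ m ∈ Fin n ] P m × (∀ j → P j → f m ≤ f j)
argminOn {n} P? f (j₀ , P-j₀) =
  argmin f j₀ candidates ,
  argmin-all f P-j₀ (all-filter P? (allFin n)) ,
  λ j P-j → All.lookup (f[argmin]≤f[xs] j₀ candidates) (∈-filter⁺ P? (∈-allFin j) P-j)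
  where
  open Extrema ℤ.≤-totalOrder
  candidates = filter P? (allFin n)

InInterval : ℤ → ℤ → ℤ → Set
InInterval lo hi p = lo ≤ p × p ≤ hi

inInterval? : ∀ lo hi p → Dec (InInterval lo hi p)
inInterval? lo hi p = lo ℤ.≤? p ×-dec p ℤ.≤? hi

indicator : ∀ {P : Set} → Dec P → ℤ
indicator (yes _) = + 1
indicator (no  _) = +0

indicator-yes : ∀ {P : Set} (P? : Dec P) → P → indicator P? ≡ + 1
indicator-yes (yes _) _ = refl
indicator-yes (no ¬p) p = ⊥-elim (¬p p)

indicator-no : ∀ {P : Set} (P? : Dec P) → ¬ P → indicator P? ≡ +0
indicator-no (yes p) ¬p = ⊥-elim (¬p p)
indicator-no (no _)  _  = refl

indicator-cong : ∀ {P Q : Set} (P? : Dec P) (Q? : Dec Q) → (P → Q) → (Q → P) → indicator P? ≡ indicator Q?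
indicator-cong (yes p) Q? P⇒Q Q⇒P = sym (indicator-yes Q? (P⇒Q p))
indicator-cong (no ¬p) Q? P⇒Q Q⇒P = sym (indicator-no Q? (λ q → ¬p (Q⇒P q)))

intervalMatrix : ∀ {m n} → (Fin m → ℤ) → (lo hi : Fin n → ℤ) → Matrix m n
intervalMatrix pos lo hi i j = indicator (inInterval? (lo j) (hi j) (pos i))

nextLo : ∀ {P : Set} → Dec P → ℤ → ℤ → ℤ
nextLo (yes _) hs lc = ℤ.suc hs
nextLo (no _)  hs lc = lc

-- If [lc, hc] passes through the lowest position p₀, subtracting the indicator of the shorter interval
-- [ls, hs] through p₀ leaves the indicator of (hs, hc].
indicator-difference : ∀ {p p₀ ls hs lc hc} →
  p₀ ≤ p → InInterval ls hs p₀ → (InInterval lc hc p₀ → hs ≤ hc) →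
  indicator (inInterval? lc hc p) - indicator (inInterval? lc hc p₀) * indicator (inInterval? ls hs p)
    ≡ indicator (inInterval? (nextLo (inInterval? lc hc p₀) hs lc) hc p)
indicator-difference {p} {p₀} {ls} {hs} {lc} {hc} p₀≤p (ls≤p₀ , _) shorter with inInterval? lc hc p₀
... | no _ = x-0*y≡x (indicator (inInterval? lc hc p)) (indicator (inInterval? ls hs p))
  where
  x-0*y≡x : ∀ x y → x - +0 * y ≡ x
  x-0*y≡x = solve-∀
... | yes c-through@(lc≤p₀ , _) with toSum (p ℤ.≤? hs)
...   | inj₁ p≤hs =
  trans (cong₂ (λ x y → x - + 1 * y)
               (indicator-yes (inInterval? lc hc p) (ℤ.≤-trans lc≤p₀ p₀≤p , ℤ.≤-trans p≤hs (shorter c-through)))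
               (indicator-yes (inInterval? ls hs p) (ℤ.≤-trans ls≤p₀ p₀≤p , p≤hs)))
        (sym (indicator-no (inInterval? (ℤ.suc hs) hc p)
                           (λ (hs<p , _) → ℤ.<⇒≱ (ℤ.suc[i]≤j⇒i<j hs<p) p≤hs)))
...   | inj₂ p≰hs =
  trans (cong (λ y → indicator (inInterval? lc hc p) - + 1 * y)
              (indicator-no (inInterval? ls hs p) (λ (_ , p≤hs) → p≰hs p≤hs)))
  (trans (x-1*0≡x (indicator (inInterval? lc hc p)))
         (indicator-cong (inInterval? lc hc p) (inInterval? (ℤ.suc hs) hc p)
                         (λ (_ , p≤hc) → ℤ.i<j⇒suc[i]≤j (ℤ.≰⇒> p≰hs) , p≤hc)
                         (λ (_ , p≤hc) → ℤ.≤-trans lc≤p₀ p₀≤p , p≤hc)))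
  where
  x-1*0≡x : ∀ x → x - + 1 * +0 ≡ x
  x-1*0≡x = solve-∀

moveToFront : ∀ {k} → Fin (suc k) → Fin (suc k) → Fin (suc k)
moveToFront a zero    = a
moveToFront a (suc i) = punchIn a i

pivotLo : ∀ {k} (pos lo hi : Fin (suc k) → ℤ) (s : Fin (suc k)) → Fin k → ℤ
pivotLo pos lo hi s j = nextLo (inInterval? (lo (punchIn s j)) (hi (punchIn s j)) (pos zero)) (hi s) (lo (punchIn s j))

pivotMinor-intervalMatrix : ∀ {k} (pos lo hi : Fin (suc k) → ℤ) (s : Fin (suc k)) →
  (∀ i → pos zero ≤ pos i) → InInterval (lo s) (hi s) (pos zero) →
  (∀ c → InInterval (lo c) (hi c) (pos zero) → hi s ≤ hi c) →
  ∀ r j → pivotMinor (intervalMatrix pos lo hi) s r j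
        ≡ intervalMatrix (λ i → pos (suc i)) (pivotLo pos lo hi s) (λ j → hi (punchIn s j)) r j
pivotMinor-intervalMatrix pos lo hi s lowest s-through shortest r j =
  indicator-difference (lowest (suc r)) s-through (shortest (punchIn s j))

det-intervalMatrix : ∀ {k} (pos lo hi : Fin k → ℤ) → Unimodular (det (intervalMatrix pos lo hi))
det-intervalMatrix {zero}  pos lo hi = inj₂ (inj₁ refl)
det-intervalMatrix {suc k} pos lo hi with argminOn (λ _ → yes tt) pos (zero , tt)
... | a , _ , a-lowest =
  Unimodular-unsign a (det-move-row-to-front a (intervalMatrix pos-a lo hi) (intervalMatrix pos lo hi)
                                             (λ c → refl) (λ i c → refl))
    (lowest-first pos-a (λ r → a-lowest (moveToFront a r) tt))
  where
  pos-a : Fin (suc k) → ℤ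
  pos-a r = pos (moveToFront a r)
  lowest-first : ∀ pos → (∀ i → pos zero ≤ pos i) → Unimodular (det (intervalMatrix pos lo hi))
  lowest-first pos lowest with any? (λ c → inInterval? (lo c) (hi c) (pos zero))
  ... | no none-through =
    inj₁ (det-zero-row₀ (intervalMatrix pos lo hi) λ c →
            indicator-no (inInterval? (lo c) (hi c) (pos zero)) (λ c-through → none-through (c , c-through)))
  ... | yes some-through with argminOn (λ c → inInterval? (lo c) (hi c) (pos zero)) hi some-through
  ...   | s , s-through , shortest =
    Unimodular-unsign s (det-pivotMinor (intervalMatrix pos lo hi) s (indicator-yes _ s-through))
      (subst Unimodular (sym (det-cong (pivotMinor-intervalMatrix pos lo hi s lowest s-through shortest)))
         (det-intervalMatrix (λ i → pos (suc i)) (pivotLo pos lo hi s) (λ j → hi (punchIn s j))))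

intervalMatrix-totallyUnimodular : ∀ {m n} (pos : Fin m → ℤ) (lo hi : Fin n → ℤ) →
  TotallyUnimodular (intervalMatrix pos lo hi)
intervalMatrix-totallyUnimodular pos lo hi k r c _ _ =
  det-intervalMatrix (λ i → pos (r i)) (λ j → lo (c j)) (λ j → hi (c j))

-- Ordinal objectives

stackScalars : ∀ {p q} → ℤ → ℤ → Fin (p ℕ.+ suc q) → ℤ
stackScalars {p} α β ρ with splitAt p ρ
... | inj₁ _       = α
... | inj₂ zero    = + 1
... | inj₂ (suc _) = β

stack3-scale : ∀ {p q n} (α β : ℤ) (T : Matrix p n) (row : Fin n → ℤ) (B : Matrix q n) ρ j →
  stack3 (scale α T) row (scale β B) ρ j ≡ stackScalars α β ρ * stack3 T row B ρ j
stack3-scale {p} α β T row B ρ j with splitAt p ρ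
... | inj₁ _       = refl
... | inj₂ zero    = sym (*-identityˡ (row j))
... | inj₂ (suc _) = refl

Unimodular-stackScalars : ∀ {p q} {α β} → InUnitSet α → InUnitSet β → (ρ : Fin (p ℕ.+ suc q)) →
  Unimodular (stackScalars α β ρ)
Unimodular-stackScalars {p} α-unit β-unit ρ with splitAt p ρ
... | inj₁ _       = InUnitSet⇒Unimodular α-unit
... | inj₂ zero    = inj₂ (inj₁ refl)
... | inj₂ (suc _) = InUnitSet⇒Unimodular β-unit

costMatrix-indicator : ∀ {n K} (o : OrdinalObjective n K) j i → costMatrix o j i ≡ indicator (j Fin.≤? o i)
costMatrix-indicator o j i with j Fin.≤? o i
... | yes _ = refl
... | no _  = refl

-- The rows of C̃ sit at positions 0, -1, -2, …, the ones row at 1 and the rows of Ĉ at 2, 3, …;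
-- column i of the stacked matrix is then the indicator of [-õ(i), ô(i) + 2].
stackPos : ∀ {p q} → Fin (p ℕ.+ suc q) → ℤ
stackPos {p} ρ with splitAt p ρ
... | inj₁ a       = - (+ toℕ a)
... | inj₂ zero    = + 1
... | inj₂ (suc b) = + suc (suc (toℕ b))

stackLo : ∀ {n K} → OrdinalObjective n K → Fin n → ℤ
stackLo õ i = - (+ toℕ (õ i))

stackHi : ∀ {n K} → OrdinalObjective n K → Fin n → ℤ
stackHi ô i = + suc (suc (toℕ (ô i)))

stack3-costMatrix-intervalMatrix : ∀ {n K̃ K̂} (õ : OrdinalObjective n K̃) (ô : OrdinalObjective n K̂) ρ i →
  stack3 (costMatrix õ) onesRow (costMatrix ô) ρ i
    ≡ intervalMatrix (stackPos {K̃} {K̂}) (stackLo õ) (stackHi ô) ρ i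
stack3-costMatrix-intervalMatrix {K̃ = K̃} õ ô ρ i with splitAt K̃ ρ
... | inj₁ a =
  trans (costMatrix-indicator õ a i)
        (indicator-cong _ _ (λ a≤õi → ℤ.neg-mono-≤ (ℤ.+≤+ a≤õi) , ℤ.neg-≤-pos)
                            (λ (-õi≤-a , _) → ℤ.drop‿+≤+ (ℤ.neg-cancel-≤ -õi≤-a)))
... | inj₂ zero = sym (indicator-yes _ (ℤ.neg-≤-pos , ℤ.+≤+ (s≤s z≤n)))
... | inj₂ (suc b) =
  trans (costMatrix-indicator ô b i)
        (indicator-cong _ _ (λ b≤ôi → ℤ.neg-≤-pos , ℤ.+≤+ (s≤s (s≤s b≤ôi)))
                            (λ (_ , b+2≤ôi+2) → s≤s⁻¹ (s≤s⁻¹ (ℤ.drop‿+≤+ b+2≤ôi+2))))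

corollary2 : ∀ (n K̃ K̂ : ℕ) (α β : ℤ) → InUnitSet α → InUnitSet β →
    (õ : OrdinalObjective n K̃) (ô : OrdinalObjective n K̂) →
    TotallyUnimodular (stack3 (scale α (costMatrix õ)) onesRow (scale β (costMatrix ô)))
corollary2 n K̃ K̂ α β α-unit β-unit õ ô =
  TotallyUnimodular-cong (λ ρ i → sym (entries ρ i))
    (TotallyUnimodular-scale-rows (stackScalars α β) interval (Unimodular-stackScalars α-unit β-unit)
      (intervalMatrix-totallyUnimodular stackPos (stackLo õ) (stackHi ô)))
  where
  interval : Matrix (K̃ ℕ.+ suc K̂) n
  interval = intervalMatrix stackPos (stackLo õ) (stackHi ô)
  entries : ∀ ρ i → stack3 (scale α (costMatrix õ)) onesRow (scale β (costMatrix ô)) ρ i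
                  ≡ stackScalars α β ρ * interval ρ i
  entries ρ i = trans (stack3-scale α β (costMatrix õ) onesRow (costMatrix ô) ρ i)
                      (cong (stackScalars α β ρ *_) (stack3-costMatrix-intervalMatrix õ ô ρ i))
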